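{- For every integer $r\ge2$ and every positive integer $m$, $N^{\mathrm{F}}_{r,2,2}(m)=(r-1)(m-1)$.
   Context: An $(r,s)$-formation is a concatenation of $s$ permutations of the same set of $r$ distinct symbols; a sequence contains one if some (not necessarily contiguous) subsequence is an $(r,s)$-formation. An $\mathrm{AFF}_{r,s,k}(m)$ sequence is a sequence (not required to be sparse) containing no $(r,s)$-formation, partitionable into at most $m$ contiguous blocks each composed of distinct symbols, in which each symbol appears at least $k$ times. $N^{\mathrm{F}}_{r,s,k}(m)$ is the maximum number of distinct symbols in an $\mathrm{AFF}_{r,s,k}(m)$ sequence. -}

module Defs where

open import Data.Nat using (ℕ; _≤_; _≟_)
open import Data.List using (List; length; concat; filter; deduplicate)
open import Data.List.Relation.Unary.All using (All)
open import Data.List.Relation.Unary.Unique.Propositional using (Unique)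
open import Data.List.Membership.Propositional using (_∈_)
open import Data.List.Relation.Binary.Permutation.Propositional using (_↭_)
open import Data.List.Relation.Binary.Sublist.Propositional using (_⊆_)
open import Data.Product using (Σ; _×_)
open import Relation.Binary.PropositionalEquality using (_≡_)
open import Relation.Nullary using (¬_)

Seq : Set
Seq = List ℕ

IsFormation : ℕ → ℕ → Seq → Set
IsFormation r s f =
  Σ (List ℕ) λ xs → length xs ≡ r × Unique xs ×
  Σ (List (List ℕ)) λ ps → length ps ≡ s × All (_↭ xs) ps × f ≡ concat ps

ContainsFormation : ℕ → ℕ → Seq → Set
ContainsFormation r s u = Σ Seq λ f → f ⊆ u × IsFormation r s f

BlockPartition : ℕ → Seq → Set
BlockPartition m u =
  Σ (List Seq) λ bs → length bs ≤ m × concat bs ≡ u × All Unique bs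

occ : ℕ → Seq → ℕ
occ x u = length (filter (x ≟_) u)

distinctCount : Seq → ℕ
distinctCount u = length (deduplicate _≟_ u)

AFF : ℕ → ℕ → ℕ → ℕ → Seq → Set
AFF r s k m u =
  ¬ ContainsFormation r s u × BlockPartition m u ×
  (∀ x → x ∈ u → k ≤ occ x u)

-- N^F_{r,s,k}(m) = n : n is the maximum number of distinct symbols of an
-- AFF_{r,s,k}(m) sequence (attained, and an upper bound).
NF-is : ℕ → ℕ → ℕ → ℕ → ℕ → Set
NF-is r s k m n =
  (Σ Seq λ u → AFF r s k m u × distinctCount u ≡ n) ×
  (∀ u → AFF r s k m u → distinctCount u ≤ n)

-- Upper bound.  Let s = r − 1 and let b₁ … b_m be the blocks.  A symbol occurring
-- twice lies in two blocks, so it is "recurring" in the first block b_i that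
-- contains it: it belongs to  shared b_i (b_{i+1} ⋯ b_m).  If s + 1 symbols were
-- shared by b_i and the rest, they would appear once in b_i and once afterwards,
-- i.e. an (r,2)-formation.  Hence every block shares at most s symbols with the
-- rest, the last one shares none, and at most s(m − 1) symbols occur.
--
-- Lower bound.  With groups G_j of s fresh symbols, let U_0 = ∅ and
-- U_{j+1} = G_j G_j U_j.  Then U_j has the m = j + 1 blocks
-- G_{j−1} | G_{j−1} G_{j−2} | … | G_1 G_0 | G_0 , every symbol occurs twice,
-- and it uses the j·s symbols 0 … j·s − 1.  Any cut of U_j leaves only the symbols
-- of a single group on both sides, so U_j has no (s+1,2)-formation.
module Submission where

open import Defs
open import Data.Nat using (ℕ; zero; suc; _≤_; _<_; _∸_; _*_; _+_; _≟_; z≤n; s≤s)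
open import Data.Nat.Properties
open import Data.List using (List; []; _∷_; _++_; [_]; length; concat; filter; deduplicate; take; applyUpTo; upTo)
open import Data.List.Properties
  using (length-++; filter-++; ++-identityʳ; ++-assoc; ∷-injective; length-take;
         filter-some; filter-none; length-applyUpTo; length-upTo)
open import Data.List.Relation.Unary.All as All using (All; []; _∷_)
open import Data.List.Relation.Unary.All.Properties using (¬Any⇒All¬)
open import Data.List.Relation.Unary.Any using (here)
open import Data.List.Relation.Unary.AllPairs using ([])
open import Data.List.Relation.Unary.Unique.Propositional using (Unique)
open import Data.List.Relation.Unary.Unique.Propositional.Properties using (++⁺; filter⁺; take⁺; applyUpTo⁺₁; upTo⁺)
open import Data.List.Relation.Unary.Unique.DecPropositional.Properties _≟_ using (deduplicate-!)
open import Data.List.Membership.Propositional using (_∈_; _∉_)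
open import Data.List.Membership.Propositional.Properties
  using (∈-++⁺ˡ; ∈-++⁺ʳ; ∈-++⁻; ∈-filter⁺; ∈-filter⁻; ∈-deduplicate⁺; ∈-deduplicate⁻; ∈-applyUpTo⁺; ∈-applyUpTo⁻; ∈-upTo⁻)
open import Data.List.Membership.Propositional.Properties.WithK using (unique∧set⇒bag)
open import Data.List.Membership.DecPropositional _≟_ using (_∈?_)
open import Data.List.Relation.Binary.BagAndSetEquality using (∼bag⇒↭)
open import Data.List.Relation.Binary.Permutation.Propositional using (_↭_; ↭-sym)
open import Data.List.Relation.Binary.Permutation.Propositional.Properties using (∈-resp-↭; ↭-length)
open import Data.List.Relation.Binary.Sublist.Propositional using (_⊆_; []; _∷_; _∷ʳ_; ⊆-trans) renaming (lookup to ∈-resp-⊆)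
open import Data.List.Relation.Binary.Sublist.Propositional.Properties using (filter-⊆; take-⊆; length-mono-≤) renaming (++⁺ to ⊆-++⁺; ++⁺ˡ to ⊆-++⁺ˡ)
open import Data.Product using (∃; ∃₂; _×_; _,_; proj₁; proj₂)
open import Data.Sum using (_⊎_; inj₁; inj₂)
open import Function using (_∘_; _⇔_; mk⇔)
open import Relation.Binary.Definitions using (DecidableEquality)
open import Relation.Binary.PropositionalEquality using (_≡_; refl; sym; trans; cong; subst; module ≡-Reasoning)
open import Relation.Nullary using (¬_; yes; no; contradiction)

module _ {A : Set} where

  unique-↭ : {xs ys : List A} → Unique xs → Unique ys → (∀ {x} → x ∈ xs ⇔ x ∈ ys) → xs ↭ ys
  unique-↭ uxs uys same = ∼bag⇒↭ (unique∧set⇒bag uxs uys same)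

  ⊆-++-split : ∀ (p₁ : List A) {p₂ w} → p₁ ++ p₂ ⊆ w →
               ∃₂ λ w₁ w₂ → w ≡ w₁ ++ w₂ × p₁ ⊆ w₁ × p₂ ⊆ w₂
  ⊆-++-split [] {w = w} p₂⊆w = [] , w , refl , [] , p₂⊆w
  ⊆-++-split (y ∷ p₁) (z ∷ʳ p⊆w) with ⊆-++-split (y ∷ p₁) p⊆w
  ... | w₁ , w₂ , refl , p₁⊆w₁ , p₂⊆w₂ = z ∷ w₁ , w₂ , refl , z ∷ʳ p₁⊆w₁ , p₂⊆w₂
  ⊆-++-split (y ∷ p₁) (refl ∷ p⊆w) with ⊆-++-split p₁ p⊆w
  ... | w₁ , w₂ , refl , p₁⊆w₁ , p₂⊆w₂ = y ∷ w₁ , w₂ , refl , refl ∷ p₁⊆w₁ , p₂⊆w₂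

  ++-cut : ∀ (xs : List A) {v w₁ w₂} → w₁ ++ w₂ ≡ xs ++ v →
           (∃ λ t → xs ≡ w₁ ++ t) ⊎ (∃ λ w₁′ → w₁ ≡ xs ++ w₁′ × w₁′ ++ w₂ ≡ v)
  ++-cut []       {w₁ = w₁}     eq = inj₂ (w₁ , refl , eq)
  ++-cut (a ∷ xs) {w₁ = []}     eq = inj₁ (a ∷ xs , refl)
  ++-cut (a ∷ xs) {w₁ = b ∷ w₁} eq with ∷-injective eq
  ... | refl , eq′ with ++-cut xs eq′
  ...   | inj₁ (t , xs≡) = inj₁ (t , cong (a ∷_) xs≡)
  ...   | inj₂ (w₁′ , refl , eq″) = inj₂ (w₁′ , refl , eq″)

module WithDecidableEquality {A : Set} (_≟ᴬ_ : DecidableEquality A) where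
  open import Data.List.Membership.DecPropositional _≟ᴬ_ using () renaming (_∈?_ to _∈ᴬ?_)
  open import Data.List.Relation.Unary.Unique.DecPropositional.Properties _≟ᴬ_ using () renaming (deduplicate-! to deduplicateᴬ-!)

  deduplicate-⊆ : ∀ xs → deduplicate _≟ᴬ_ xs ⊆ xs
  deduplicate-⊆ []       = []
  deduplicate-⊆ (x ∷ xs) = refl ∷ ⊆-trans (filter-⊆ _ _) (deduplicate-⊆ xs)

  embed : ∀ {xs} u → Unique xs → (∀ {x} → x ∈ xs → x ∈ u) → ∃ λ p → p ⊆ u × p ↭ xs
  embed {xs} u uxs xs⊆u =
    p , ⊆-trans (filter-⊆ _ _) (deduplicate-⊆ u) , unique-↭ (filter⁺ _ (deduplicateᴬ-! u)) uxs (mk⇔ to from)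
    where
    p = filter (_∈ᴬ? xs) (deduplicate _≟ᴬ_ u)
    to : ∀ {x} → x ∈ p → x ∈ xs
    to = proj₂ ∘ ∈-filter⁻ (_∈ᴬ? xs) {xs = deduplicate _≟ᴬ_ u}
    from : ∀ {x} → x ∈ xs → x ∈ p
    from x∈xs = ∈-filter⁺ (_∈ᴬ? xs) (∈-deduplicate⁺ _≟ᴬ_ (xs⊆u x∈xs)) x∈xs

  length-≤ : ∀ {xs} u → Unique xs → (∀ {x} → x ∈ xs → x ∈ u) → length xs ≤ length u
  length-≤ u uxs xs⊆u with embed u uxs xs⊆u
  ... | p , p⊆u , p↭xs = subst (_≤ length u) (↭-length p↭xs) (length-mono-≤ p⊆u)

open WithDecidableEquality _≟_

occ-++ : ∀ x u v → occ x (u ++ v) ≡ occ x u + occ x v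
occ-++ x u v = trans (cong length (filter-++ (x ≟_) u v)) (length-++ (filter (x ≟_) u))

occ-∈ : ∀ {x u} → x ∈ u → 1 ≤ occ x u
occ-∈ {x} = filter-some (x ≟_)

occ-∉ : ∀ {x u} → x ∉ u → occ x u ≡ 0
occ-∉ {x} {u} x∉u = cong length (filter-none (x ≟_) (¬Any⇒All¬ u x∉u))

occ-unique : ∀ x {u} → Unique u → occ x u ≤ 1
occ-unique x {u} uu = length-≤ [ x ] (filter⁺ (x ≟_) uu) (λ y∈ → here (sym (proj₂ (∈-filter⁻ (x ≟_) {xs = u} y∈))))

occ-prefix : ∀ x u v → occ x u ≤ occ x (u ++ v)
occ-prefix x u v = subst (occ x u ≤_) (sym (occ-++ x u v)) (m≤m+n _ _)

occ-suffix : ∀ x u v → occ x v ≤ occ x (u ++ v)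
occ-suffix x u v = subst (occ x v ≤_) (sym (occ-++ x u v)) (m≤n+m _ _)

contains-++ : ∀ {r s} u {w} → ContainsFormation r s w → ContainsFormation r s (u ++ w)
contains-++ u (f , f⊆w , isF) = f , ⊆-++⁺ˡ u f⊆w , isF

doubled-formation : ∀ {xs} u v → Unique xs → (∀ {x} → x ∈ xs → x ∈ u) → (∀ {x} → x ∈ xs → x ∈ v) →
                    ContainsFormation (length xs) 2 (u ++ v)
doubled-formation {xs} u v uxs xs⊆u xs⊆v with embed u uxs xs⊆u | embed v uxs xs⊆v
... | p₁ , p₁⊆u , p₁↭xs | p₂ , p₂⊆v , p₂↭xs =
  concat (p₁ ∷ p₂ ∷ []) , ⊆-++⁺ p₁⊆u (subst (_⊆ v) (sym (++-identityʳ p₂)) p₂⊆v) ,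
  xs , refl , uxs , p₁ ∷ p₂ ∷ [] , refl , p₁↭xs ∷ p₂↭xs ∷ [] , refl

shared : Seq → Seq → Seq
shared b w = filter (_∈? w) b

-- Without an (s+1,2)-formation, a block shares at most s symbols with the rest:
-- s + 1 shared symbols would form one.
shared-bound : ∀ s b w → Unique b → ¬ ContainsFormation (suc s) 2 (b ++ w) → length (shared b w) ≤ s
shared-bound s b w ub free with length (shared b w) ≤? s
... | yes bounded = bounded
... | no  big     = contradiction formation free
  where
  xs = take (suc s) (shared b w)
  |xs|≡r : length xs ≡ suc s
  |xs|≡r = trans (length-take (suc s) (shared b w)) (m≤n⇒m⊓n≡m (≰⇒> big))
  in-shared : ∀ {x} → x ∈ xs → x ∈ b × x ∈ w
  in-shared = ∈-filter⁻ (_∈? w) ∘ ∈-resp-⊆ (take-⊆ (suc s) (shared b w))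
  formation : ContainsFormation (suc s) 2 (b ++ w)
  formation = subst (λ n → ContainsFormation n 2 (b ++ w)) |xs|≡r
    (doubled-formation b w (take⁺ (suc s) (filter⁺ (_∈? w) ub)) (proj₁ ∘ in-shared) (proj₂ ∘ in-shared))

recurring : List Seq → Seq
recurring []       = []
recurring (b ∷ bs) = shared b (concat bs) ++ recurring bs

recurring-complete : ∀ {x} bs → All Unique bs → 2 ≤ occ x (concat bs) → x ∈ recurring bs
recurring-complete {x} (b ∷ bs) (ub ∷ ubs) twice with x ∈? concat bs | x ∈? b
... | no x∉rest | _ = contradiction (≤-trans twice at-most-once) 1+n≰n
  where
  at-most-once : occ x (b ++ concat bs) ≤ 1
  at-most-once = begin
    occ x (b ++ concat bs)          ≡⟨ occ-++ x b (concat bs) ⟩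
    occ x b + occ x (concat bs)     ≡⟨ cong (occ x b +_) (occ-∉ x∉rest) ⟩
    occ x b + 0                     ≡⟨ +-identityʳ _ ⟩
    occ x b                         ≤⟨ occ-unique x ub ⟩
    1                               ∎
    where open ≤-Reasoning
... | yes x∈rest | yes x∈b = ∈-++⁺ˡ (∈-filter⁺ (_∈? concat bs) x∈b x∈rest)
... | yes _      | no x∉b  = ∈-++⁺ʳ (shared b (concat bs)) (recurring-complete bs ubs twice′)
  where
  twice′ : 2 ≤ occ x (concat bs)
  twice′ = subst (2 ≤_) (trans (occ-++ x b (concat bs)) (cong (_+ occ x (concat bs)) (occ-∉ x∉b))) twice

-- At most s recurring symbols per block, none in the last block.
recurring-length : ∀ s bs → All Unique bs → ¬ ContainsFormation (suc s) 2 (concat bs) →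
                   length (recurring bs) ≤ (length bs ∸ 1) * s
recurring-length s []       _ _ = z≤n
recurring-length s (b ∷ []) _ _ =
  ≤-reflexive (cong (λ t → length (t ++ [])) (filter-none (_∈? []) {xs = b} (All.tabulate λ _ ())))
recurring-length s (b ∷ b′ ∷ bs) (ub ∷ ubs) free = begin
  length (shared b rest ++ recurring (b′ ∷ bs))          ≡⟨ length-++ (shared b rest) ⟩
  length (shared b rest) + length (recurring (b′ ∷ bs))  ≤⟨ +-mono-≤ (shared-bound s b rest ub free)
                                                                     (recurring-length s (b′ ∷ bs) ubs (free ∘ contains-++ b)) ⟩
  s + length bs * s                                      ∎
  where
  rest = concat (b′ ∷ bs)
  open ≤-Reasoning

upper-bound : ∀ s m u → AFF (suc s) 2 2 m u → distinctCount u ≤ (m ∸ 1) * s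
upper-bound s m u (free , (bs , |bs|≤m , refl , ubs) , twice) = begin
  distinctCount (concat bs)  ≤⟨ length-≤ (recurring bs) (deduplicate-! _) recurs ⟩
  length (recurring bs)      ≤⟨ recurring-length s bs ubs free ⟩
  (length bs ∸ 1) * s        ≤⟨ *-monoˡ-≤ s (∸-monoˡ-≤ 1 |bs|≤m) ⟩
  (m ∸ 1) * s                ∎
  where
  open ≤-Reasoning
  recurs : ∀ {x} → x ∈ deduplicate _≟_ (concat bs) → x ∈ recurring bs
  recurs x∈ = recurring-complete bs ubs (twice _ (∈-deduplicate⁻ _≟_ (concat bs) x∈))

module Construction (a : ℕ) where

  G : ℕ → Seq
  G j = applyUpTo (_+ j * a) a

  U : ℕ → Seq
  U zero    = []
  U (suc j) = G j ++ G j ++ U j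

  G-unique : ∀ j → Unique (G j)
  G-unique j = applyUpTo⁺₁ _ a (λ i<k _ eq → <⇒≢ i<k (+-cancelʳ-≡ (j * a) _ _ eq))

  G-length : ∀ j → length (G j) ≡ a
  G-length j = length-applyUpTo _ a

  G-range : ∀ {x} j → x ∈ G j → j * a ≤ x × x < suc j * a
  G-range j x∈ with ∈-applyUpTo⁻ (_+ j * a) x∈
  ... | i , i<a , refl = m≤n+m (j * a) i , +-monoˡ-< (j * a) i<a

  G-complete : ∀ {x} j → j * a ≤ x → x < suc j * a → x ∈ G j
  G-complete {x} j lo hi = subst (_∈ G j) (m∸n+n≡m lo) (∈-applyUpTo⁺ (_+ j * a) offset<a)
    where
    offset<a : x ∸ j * a < a
    offset<a = subst (x ∸ j * a <_) (m+n∸n≡m a (j * a)) (∸-monoˡ-< hi lo)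

  U-symbols⁻ : ∀ {x} j → x ∈ U j → x < j * a
  U-symbols⁻ (suc j) x∈ with ∈-++⁻ (G j) x∈
  ... | inj₁ x∈G = proj₂ (G-range j x∈G)
  ... | inj₂ x∈GU with ∈-++⁻ (G j) x∈GU
  ...   | inj₁ x∈G = proj₂ (G-range j x∈G)
  ...   | inj₂ x∈U = ≤-trans (U-symbols⁻ j x∈U) (m≤n+m (j * a) a)

  U-symbols⁺ : ∀ {x} j → x < j * a → x ∈ U j
  U-symbols⁺ {x} (suc j) x< with x <? j * a
  ... | yes x<ja = ∈-++⁺ʳ (G j) (∈-++⁺ʳ (G j) (U-symbols⁺ j x<ja))
  ... | no  x≮ja = ∈-++⁺ˡ (G-complete j (≮⇒≥ x≮ja) x<)

  G-fresh : ∀ {x} j → x ∈ G j → x ∉ U j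
  G-fresh j x∈G x∈U = <⇒≱ (U-symbols⁻ j x∈U) (proj₁ (G-range j x∈G))

  GG⊆G : ∀ {x} j → x ∈ G j ++ G j → x ∈ G j
  GG⊆G j x∈ with ∈-++⁻ (G j) x∈
  ... | inj₁ x∈G = x∈G
  ... | inj₂ x∈G = x∈G

  U-twice : ∀ {x} j → x ∈ U j → 2 ≤ occ x (U j)
  U-twice {x} (suc j) x∈ with ∈-++⁻ (G j ++ G j) (subst (x ∈_) (sym (++-assoc (G j) (G j) (U j))) x∈)
  ... | inj₁ x∈GG = subst (2 ≤_) (sym (occ-++ x (G j) (G j ++ U j)))
                      (+-mono-≤ (occ-∈ x∈G) (≤-trans (occ-∈ x∈G) (occ-prefix x (G j) (U j))))
    where x∈G = GG⊆G j x∈GG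
  ... | inj₂ x∈U = ≤-trans (U-twice j x∈U)
                     (≤-trans (occ-suffix x (G j) (U j)) (occ-suffix x (G j) (G j ++ U j)))

  -- U j splits into the j + 1 duplicate-free blocks
  --   G (j−1) | G (j−1) G (j−2) | … | G 1 G 0 | G 0 ;
  -- `lead j` is the first of them and `rest j` the remaining j.
  lead : ℕ → Seq
  lead zero    = []
  lead (suc j) = G j

  rest : ℕ → List Seq
  rest zero    = []
  rest (suc j) = (G j ++ lead j) ∷ rest j

  blocks : ℕ → List Seq
  blocks j = lead j ∷ rest j

  -- The blocks are duplicate-free (the first block of U j is disjoint from the
  -- fresh group G j) and there are j + 1 of them.
  lead⊆U : ∀ {x} j → x ∈ lead j → x ∈ U j
  lead⊆U (suc j) = ∈-++⁺ˡ

  lead-unique : ∀ j → Unique (lead j)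
  lead-unique zero    = []
  lead-unique (suc j) = G-unique j

  rest-unique : ∀ j → All Unique (rest j)
  rest-unique zero    = []
  rest-unique (suc j) =
    ++⁺ (G-unique j) (lead-unique j) (λ (x∈G , x∈lead) → G-fresh j x∈G (lead⊆U j x∈lead)) ∷ rest-unique j

  rest-length : ∀ j → length (rest j) ≡ j
  rest-length zero    = refl
  rest-length (suc j) = cong suc (rest-length j)

  blocks-concat : ∀ j → concat (blocks j) ≡ U j
  blocks-concat zero    = refl
  blocks-concat (suc j) = cong (G j ++_) (begin
    (G j ++ lead j) ++ concat (rest j)  ≡⟨ ++-assoc (G j) (lead j) (concat (rest j)) ⟩
    G j ++ concat (blocks j)            ≡⟨ cong (G j ++_) (blocks-concat j) ⟩
    G j ++ U j                          ∎)
    where open ≡-Reasoning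

  crossing : ∀ j {w₁ w₂} → w₁ ++ w₂ ≡ U j → ∃ λ k → ∀ {x} → x ∈ w₁ → x ∈ w₂ → x ∈ G k
  crossing zero    {[]}    _  = 0 , λ ()
  crossing (suc j) {w₁} {w₂} eq with ++-cut (G j ++ G j) (trans eq (sym (++-assoc (G j) (G j) (U j))))
  ... | inj₁ (t , GG≡) = j , λ x∈w₁ _ → GG⊆G j (subst (_ ∈_) (sym GG≡) (∈-++⁺ˡ x∈w₁))
  ... | inj₂ (w₁′ , refl , eq′) with crossing j eq′
  ...   | k , both = k , λ x∈w₁ x∈w₂ → both (in-w₁′ x∈w₁ (in-U x∈w₂)) x∈w₂
    where
    in-U : ∀ {x} → x ∈ w₂ → x ∈ U j
    in-U x∈w₂ = subst (_ ∈_) eq′ (∈-++⁺ʳ w₁′ x∈w₂)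
    in-w₁′ : ∀ {x} → x ∈ (G j ++ G j) ++ w₁′ → x ∈ U j → x ∈ w₁′
    in-w₁′ x∈ x∈U with ∈-++⁻ (G j ++ G j) x∈
    ... | inj₁ x∈GG = contradiction x∈U (G-fresh j (GG⊆G j x∈GG))
    ... | inj₂ x∈w₁′ = x∈w₁′

  -- Hence U j has no (a+1,2)-formation: its r symbols would straddle one cut.
  U-formation-free : ∀ j → ¬ ContainsFormation (suc a) 2 (U j)
  U-formation-free j (f , f⊆U , xs , |xs|≡r , uxs , p₁ ∷ p₂ ∷ [] , refl , p₁↭xs ∷ p₂↭xs ∷ [] , refl)
    with ⊆-++-split p₁ f⊆U
  ... | w₁ , w₂ , U≡ , p₁⊆w₁ , p₂⊆w₂ with crossing j (sym U≡)
  ...   | k , both = 1+n≰n (begin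
    suc a       ≡⟨ sym |xs|≡r ⟩
    length xs   ≤⟨ length-≤ (G k) uxs (λ x∈xs → both (in-w₁ x∈xs) (in-w₂ x∈xs)) ⟩
    length (G k) ≡⟨ G-length k ⟩
    a           ∎)
    where
    open ≤-Reasoning
    in-w₁ : ∀ {x} → x ∈ xs → x ∈ w₁
    in-w₁ = ∈-resp-⊆ p₁⊆w₁ ∘ ∈-resp-↭ (↭-sym p₁↭xs)
    in-w₂ : ∀ {x} → x ∈ xs → x ∈ w₂
    in-w₂ = ∈-resp-⊆ p₂⊆w₂ ∘ ∈-++⁺ˡ ∘ ∈-resp-↭ (↭-sym p₂↭xs)

  U-AFF : ∀ j → AFF (suc a) 2 2 (suc j) (U j)
  U-AFF j = U-formation-free j
          , (blocks j , s≤s (≤-reflexive (rest-length j)) , blocks-concat j , lead-unique j ∷ rest-unique j)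
          , λ _ → U-twice j

  U-distinct : ∀ j → j * a ≤ distinctCount (U j)
  U-distinct j = begin
    j * a                      ≡⟨ sym (length-upTo (j * a)) ⟩
    length (upTo (j * a))      ≤⟨ length-≤ _ (upTo⁺ (j * a)) (∈-deduplicate⁺ _≟_ ∘ U-symbols⁺ j ∘ ∈-upTo⁻) ⟩
    distinctCount (U j)        ∎
    where open ≤-Reasoning

NF-value : ∀ a j → NF-is (suc a) 2 2 (suc j) (j * a)
NF-value a j =
  (U j , U-AFF j , ≤-antisym (upper-bound a (suc j) (U j) (U-AFF j)) (U-distinct j)) , upper-bound a (suc j)
  where open Construction a

lemma5p9 : ∀ (r m : ℕ) → 2 ≤ r → 1 ≤ m → NF-is r 2 2 m ((r ∸ 1) * (m ∸ 1))
lemma5p9 (suc (suc b)) (suc j) (s≤s (s≤s z≤n)) (s≤s z≤n) =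
  subst (NF-is (suc (suc b)) 2 2 (suc j)) (*-comm j (suc b)) (NF-value (suc b) j)
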